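{- Let $n\ge 4$ be an integer and let $v_i$ be the prime Jaconian vertex of the finite Jaco graph $J_n(1)$. Then $$h(J^{\ast}_{n+1}(1))=h(J^{\ast}_n(1))+\sum_{j=1}^{(n-i)-1}\big((n-i)-j\big).$$
   Context: The infinite Jaco graph $J_\infty(1)$ is the directed graph with vertex set $\{v_k : k\in\mathbb{N}\}$ (with $\mathbb{N}=\{1,2,\dots\}$) whose arcs are defined as follows: for $k<j$, $(v_k,v_j)$ is an arc if and only if $2k-d^-(v_k)\ge j$, where $d^-(v_k)$ is the in-degree of $v_k$ in $J_\infty(1)$ (this is well defined recursively, since $d^-(v_k)$ depends only on arcs from vertices of smaller index); there are no arcs $(v_k,v_j)$ with $k\ge j$. For $n\in\mathbb{N}$, the finite Jaco graph $J_n(1)$ is the subdigraph of $J_\infty(1)$ induced by $v_1,\dots,v_n$, and $J^{\ast}_n(1)$ denotes its underlying undirected (simple) graph. The degree of a vertex in $J_n(1)$ is its degree in $J^{\ast}_n(1)$; the Jaconian vertices of $J_n(1)$ are the vertices attaining the maximum degree $\Delta(J_n(1))$, and the prime Jaconian vertex is the Jaconian vertex of smallest index. $h(G)$ denotes the number of triangles ($C_3$'s) in a graph $G$. -}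

module Defs where

open import Data.Nat using (ℕ; zero; suc; _+_; _*_; _∸_; _≤ᵇ_; _<ᵇ_)
open import Data.Bool using (Bool; true; false; _∧_; _∨_; if_then_else_)
open import Data.List using (List; []; _∷_; _++_; [_]; length; filter; map; concatMap; applyUpTo)
open import Data.Nat.ListAction using (sum)

-- Vertices of J_∞(1) are v_k for k ≥ 1, represented by the natural number k.

countᵇ : {A : Set} → (A → Bool) → List A → ℕ
countᵇ p []       = 0
countᵇ p (x ∷ xs) = (if p x then 1 else 0) + countᵇ p xs

-- reachList n = [ 2·1 ∸ d⁻(v_1) , … , 2·n ∸ d⁻(v_n) ]  (in-degrees in J_∞(1)),
-- computed recursively: d⁻(v_{n+1}) = #{ i ≤ n : 2i ∸ d⁻(v_i) ≥ n+1 }.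
reachList : ℕ → List ℕ
reachList zero    = []
reachList (suc n) = reachList n ++ [ 2 * suc n ∸ countᵇ (λ r → suc n ≤ᵇ r) (reachList n) ]

indeg : ℕ → ℕ
indeg k = countᵇ (λ r → k ≤ᵇ r) (reachList (k ∸ 1))

isArc : ℕ → ℕ → Bool
isArc i j = (i <ᵇ j) ∧ (j ≤ᵇ (2 * i ∸ indeg i))

adj : ℕ → ℕ → Bool
adj a b = isArc a b ∨ isArc b a

verts : ℕ → List ℕ
verts n = applyUpTo suc n

deg : ℕ → ℕ → ℕ
deg n k = countᵇ (λ j → adj k j) (verts n)

triangles : ℕ → ℕ
triangles n =
  countᵇ (λ a → true) (concatMap (λ a → concatMap (λ b → concatMap (λ c →
    if (a <ᵇ b) ∧ (b <ᵇ c) ∧ adj a b ∧ adj b c ∧ adj a c then [ a ] else [])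
    (verts n)) (verts n)) (verts n))

open import Data.Nat using (_≤_; _<_)
open import Data.Product using (_×_)

IsPrimeJaconian : ℕ → ℕ → Set
IsPrimeJaconian n i =
  1 ≤ i × i ≤ n
  × (∀ k → 1 ≤ k → k ≤ n → deg n k ≤ deg n i)
  × (∀ k → 1 ≤ k → k < i → deg n k < deg n i)

innerSum : ℕ → ℕ
innerSum m = sum (map (λ j → m ∸ j) (applyUpTo suc (m ∸ 1)))

module Submission where

-- Write reach k = 2k ∸ d⁻(v_k); then (v_k , v_j) is an arc exactly when
-- k < j ≤ reach k.  The proof rests on three facts about J_∞(1).
--  (1) d⁻(v_{k+1}) ≤ d⁻(v_k) + 1: every tail of an arc into v_{k+1} other than
--      v_k is a tail of an arc into v_k.  Hence reach is strictly increasing,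
--      and reach k > k because d⁻(v_k) < k.
--  (2) For 1 ≤ k ≤ n: deg_n(v_k) = k if reach k ≤ n, and
--      deg_n(v_k) = d⁻(v_k) + (n − k) if reach k > n.  So the degrees grow
--      while the reach stays inside J_n(1) and do not grow afterwards.
--  (3) Hence the prime Jaconian vertex v_i satisfies reach i ≤ n < reach (i+1).
-- The triangles of J*_{n+1}(1) that are not in J*_n(1) are the triples
-- v_a, v_b, v_{n+1} with a < b ≤ n.  By (3) the neighbours of v_{n+1} are
-- v_{i+1}, …, v_n, and they are pairwise adjacent, so each v_a with i < a ≤ n
-- contributes n − a new triangles; these add up to Σ_{j=1}^{m-1} (m − j) with
-- m = n − i.

open import Defs
open import Data.Nat using (ℕ; zero; suc; _+_; _*_; _∸_; _≤_; _<_; _≤ᵇ_; _<ᵇ_; _⊓_; z≤n; s≤s; s≤s⁻¹; _≤?_; _<?_)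
open import Data.Nat.Properties
open import Algebra.Properties.CommutativeSemigroup +-commutativeSemigroup using () renaming (interchange to +-interchange)
open import Data.Bool using (Bool; true; false; _∧_; if_then_else_)
open import Data.Bool.Properties using (T-≡; ¬-not; ∧-zeroʳ; ∧-identityʳ; ∨-identityʳ)
open import Data.List using (List; []; _∷_; _++_; [_]; map; concatMap)
open import Data.List.Properties using (applyUpTo-∷ʳ; map-++; ++-assoc; ++-identityʳ)
open import Data.Nat.ListAction using (sum)
open import Data.Nat.ListAction.Properties using (sum-++)
open import Data.Product using (_×_; _,_)
open import Data.Sum using (inj₁; inj₂)
open import Function.Bundles using (Equivalence)
open import Data.Empty using (⊥; ⊥-elim)
open import Relation.Nullary using (Dec; yes; no; contradiction)
open import Relation.Binary.PropositionalEquality using (_≡_; refl; sym; trans; cong; cong₂; subst; subst₂; module ≡-Reasoning)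

χ : Bool → ℕ
χ b = if b then 1 else 0

χ≤1 : ∀ b → χ b ≤ 1
χ≤1 true  = ≤-refl
χ≤1 false = z≤n

≤ᵇ-true : ∀ {m n} → m ≤ n → (m ≤ᵇ n) ≡ true
≤ᵇ-true m≤n = Equivalence.to T-≡ (≤⇒≤ᵇ m≤n)

≤ᵇ-false : ∀ {m n} → n < m → (m ≤ᵇ n) ≡ false
≤ᵇ-false {m} {n} n<m = ¬-not (λ eq → <⇒≱ n<m (≤ᵇ⇒≤ m n (Equivalence.from T-≡ eq)))

-- m <ᵇ n is definitionally suc m ≤ᵇ n.
<ᵇ-true : ∀ {m n} → m < n → (m <ᵇ n) ≡ true
<ᵇ-true = ≤ᵇ-true

<ᵇ-false : ∀ {m n} → n ≤ m → (m <ᵇ n) ≡ false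
<ᵇ-false n≤m = ≤ᵇ-false (s≤s n≤m)

<ᵇ-sound : ∀ {m n} → (m <ᵇ n) ≡ true → m < n
<ᵇ-sound {m} {n} eq = <ᵇ⇒< m n (Equivalence.from T-≡ eq)

∧-absorb : ∀ p q x y → (p ≡ true → q ≡ true → x ≡ true × y ≡ true) → p ∧ true ∧ x ∧ y ∧ q ≡ p ∧ q
∧-absorb false q     x y _ = refl
∧-absorb true  false x y _ = trans (cong (x ∧_) (∧-zeroʳ y)) (∧-zeroʳ x)
∧-absorb true  true  x y forced with forced refl refl
... | refl , refl = refl

χ-≤ᵇ-antitone : ∀ {t u} x → t ≤ u → χ (u ≤ᵇ x) ≤ χ (t ≤ᵇ x)
χ-≤ᵇ-antitone {t} {u} x t≤u with u ≤? x
... | yes u≤x rewrite ≤ᵇ-true u≤x | ≤ᵇ-true (≤-trans t≤u u≤x) = ≤-refl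
... | no u≰x  rewrite ≤ᵇ-false (≰⇒> u≰x) = z≤n

sumTo : (ℕ → ℕ) → ℕ → ℕ
sumTo f zero    = 0
sumTo f (suc n) = sumTo f n + f (suc n)

sumTo-cong : ∀ {f g} n → (∀ j → 1 ≤ j → j ≤ n → f j ≡ g j) → sumTo f n ≡ sumTo g n
sumTo-cong zero    eq = refl
sumTo-cong (suc n) eq =
  cong₂ _+_ (sumTo-cong n (λ j 1≤j j≤n → eq j 1≤j (m≤n⇒m≤1+n j≤n))) (eq (suc n) (s≤s z≤n) ≤-refl)

sumTo-mono : ∀ {f g} n → (∀ j → 1 ≤ j → j ≤ n → f j ≤ g j) → sumTo f n ≤ sumTo g n
sumTo-mono zero    le = z≤n
sumTo-mono (suc n) le =
  +-mono-≤ (sumTo-mono n (λ j 1≤j j≤n → le j 1≤j (m≤n⇒m≤1+n j≤n))) (le (suc n) (s≤s z≤n) ≤-refl)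

sumTo-vanish : ∀ {f} n → (∀ j → 1 ≤ j → j ≤ n → f j ≡ 0) → sumTo f n ≡ 0
sumTo-vanish zero    eq = refl
sumTo-vanish (suc n) eq =
  cong₂ _+_ (sumTo-vanish n (λ j 1≤j j≤n → eq j 1≤j (m≤n⇒m≤1+n j≤n))) (eq (suc n) (s≤s z≤n) ≤-refl)

sumTo-+ : ∀ (f g : ℕ → ℕ) n → sumTo (λ j → f j + g j) n ≡ sumTo f n + sumTo g n
sumTo-+ f g zero    = refl
sumTo-+ f g (suc n) rewrite sumTo-+ f g n = +-interchange (sumTo f n) (sumTo g n) (f (suc n)) (g (suc n))

sumTo-split : ∀ (f : ℕ → ℕ) k l → sumTo f (k + l) ≡ sumTo f k + sumTo (λ j → f (k + j)) l
sumTo-split f k zero    rewrite +-identityʳ k = sym (+-identityʳ (sumTo f k))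
sumTo-split f k (suc l) rewrite +-suc k l | sumTo-split f k l =
  +-assoc (sumTo f k) (sumTo (λ j → f (k + j)) l) (f (suc (k + l)))

count-≤ : ∀ (p : ℕ → Bool) n → sumTo (λ j → χ (p j)) n ≤ n
count-≤ p n = ≤-trans (sumTo-mono {g = λ _ → 1} n (λ j _ _ → χ≤1 (p j))) (≤-reflexive (sumTo-const-1 n))
  where
  sumTo-const-1 : ∀ n → sumTo (λ _ → 1) n ≡ n
  sumTo-const-1 zero    = refl
  sumTo-const-1 (suc n) = trans (cong (_+ 1) (sumTo-const-1 n)) (+-comm n 1)

count-above : ∀ a n → sumTo (λ b → χ (a <ᵇ b)) n ≡ n ∸ a
count-above a zero = sym (0∸n≡0 a)
count-above a (suc n) with a <? suc n
... | yes a<sn rewrite <ᵇ-true a<sn | count-above a n =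
      trans (+-comm (n ∸ a) 1) (sym (+-∸-assoc 1 (s≤s⁻¹ a<sn)))
... | no a≮sn rewrite <ᵇ-false (≮⇒≥ a≮sn) | count-above a n =
      trans (+-identityʳ (n ∸ a)) (trans (m≤n⇒m∸n≡0 (≤-trans (n≤1+n n) (≮⇒≥ a≮sn)))
                                         (sym (m≤n⇒m∸n≡0 (≮⇒≥ a≮sn))))

count-window : ∀ c t l → sumTo (λ j → χ (c + j ≤ᵇ t)) l ≡ (t ∸ c) ⊓ l
count-window c t zero = sym (⊓-zeroʳ (t ∸ c))
count-window c t (suc l) with c + suc l ≤? t
... | yes fits rewrite ≤ᵇ-true fits | count-window c t l =
      trans (cong (_+ 1) (m≥n⇒m⊓n≡n (<⇒≤ room))) (trans (+-comm l 1) (sym (m≥n⇒m⊓n≡n room)))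
  where
  room : suc l ≤ t ∸ c
  room = subst (_≤ t ∸ c) (m+n∸m≡n c (suc l)) (∸-monoˡ-≤ c fits)
... | no misses rewrite ≤ᵇ-false (≰⇒> misses) | count-window c t l =
      trans (+-identityʳ _) (trans (m≤n⇒m⊓n≡m (s≤s⁻¹ short)) (sym (m≤n⇒m⊓n≡m (<⇒≤ short))))
  where
  short : t ∸ c < suc l
  short = m<n+o⇒m∸n<o t c (≰⇒> misses)

sumTo-tail : ∀ (f : ℕ → ℕ) i m → sumTo (λ a → χ (i <ᵇ a) * f a) (i + m) ≡ sumTo (λ j → f (i + j)) m
sumTo-tail f i m = begin
  sumTo g (i + m)                          ≡⟨ sumTo-split g i m ⟩
  sumTo g i + sumTo (λ j → g (i + j)) m    ≡⟨ cong₂ _+_ (sumTo-vanish {g} i head) (sumTo-cong m tail) ⟩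
  sumTo (λ j → f (i + j)) m                ∎
  where
  open ≡-Reasoning
  g : ℕ → ℕ
  g a = χ (i <ᵇ a) * f a
  head : ∀ a → 1 ≤ a → a ≤ i → g a ≡ 0
  head a _ a≤i rewrite <ᵇ-false a≤i = refl
  tail : ∀ j → 1 ≤ j → j ≤ m → g (i + j) ≡ f (i + j)
  tail j 1≤j _ rewrite <ᵇ-true (m<m+n i 1≤j) = +-identityʳ (f (i + j))

countᵇ-++ : ∀ {A : Set} (p : A → Bool) xs ys → countᵇ p (xs ++ ys) ≡ countᵇ p xs + countᵇ p ys
countᵇ-++ p []       ys = refl
countᵇ-++ p (x ∷ xs) ys = trans (cong (χ (p x) +_) (countᵇ-++ p xs ys)) (sym (+-assoc (χ (p x)) _ _))

verts-suc : ∀ n → verts (suc n) ≡ verts n ++ [ suc n ]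
verts-suc n = sym (applyUpTo-∷ʳ suc n)

countᵇ-verts : ∀ (p : ℕ → Bool) n → countᵇ p (verts n) ≡ sumTo (λ j → χ (p j)) n
countᵇ-verts p zero    = refl
countᵇ-verts p (suc n) = begin
  countᵇ p (verts (suc n))                  ≡⟨ cong (countᵇ p) (verts-suc n) ⟩
  countᵇ p (verts n ++ [ suc n ])           ≡⟨ countᵇ-++ p (verts n) [ suc n ] ⟩
  countᵇ p (verts n) + (χ (p (suc n)) + 0)  ≡⟨ cong₂ _+_ (countᵇ-verts p n) (+-identityʳ (χ (p (suc n)))) ⟩
  sumTo (λ j → χ (p j)) (suc n)             ∎
  where open ≡-Reasoning

countᵇ-concatMap-verts : ∀ {B : Set} (p : B → Bool) (g : ℕ → List B) n →
  countᵇ p (concatMap g (verts n)) ≡ sumTo (λ x → countᵇ p (g x)) n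
countᵇ-concatMap-verts p g zero    = refl
countᵇ-concatMap-verts p g (suc n) = begin
  countᵇ p (concatMap g (verts (suc n)))
    ≡⟨ cong (λ xs → countᵇ p (concatMap g xs)) (verts-suc n) ⟩
  countᵇ p (concatMap g (verts n ++ [ suc n ]))
    ≡⟨ cong (countᵇ p) (concatMap-++ (verts n) [ suc n ]) ⟩
  countᵇ p (concatMap g (verts n) ++ g (suc n) ++ [])
    ≡⟨ countᵇ-++ p (concatMap g (verts n)) _ ⟩
  countᵇ p (concatMap g (verts n)) + countᵇ p (g (suc n) ++ [])
    ≡⟨ cong₂ _+_ (countᵇ-concatMap-verts p g n) (cong (countᵇ p) (++-identityʳ (g (suc n)))) ⟩
  sumTo (λ x → countᵇ p (g x)) (suc n) ∎
  where
  open ≡-Reasoning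
  concatMap-++ : ∀ xs ys → concatMap g (xs ++ ys) ≡ concatMap g xs ++ concatMap g ys
  concatMap-++ []       ys = refl
  concatMap-++ (x ∷ xs) ys = trans (cong (g x ++_) (concatMap-++ xs ys)) (sym (++-assoc (g x) _ _))

sum-map-verts : ∀ (f : ℕ → ℕ) n → sum (map f (verts n)) ≡ sumTo f n
sum-map-verts f zero    = refl
sum-map-verts f (suc n) = begin
  sum (map f (verts (suc n)))               ≡⟨ cong (λ xs → sum (map f xs)) (verts-suc n) ⟩
  sum (map f (verts n ++ [ suc n ]))        ≡⟨ cong sum (map-++ f (verts n) [ suc n ]) ⟩
  sum (map f (verts n) ++ [ f (suc n) ])    ≡⟨ sum-++ (map f (verts n)) [ f (suc n) ] ⟩
  sum (map f (verts n)) + (f (suc n) + 0)   ≡⟨ cong₂ _+_ (sum-map-verts f n) (+-identityʳ (f (suc n))) ⟩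
  sumTo f (suc n)                           ∎
  where open ≡-Reasoning

-- reach k = 2k ∸ d⁻(v_k): the largest index that v_k sends an arc to.
reach : ℕ → ℕ
reach k = 2 * k ∸ indeg k

countᵇ-reachList : ∀ (p : ℕ → Bool) n → countᵇ p (reachList n) ≡ sumTo (λ j → χ (p (reach j))) n
countᵇ-reachList p zero    = refl
countᵇ-reachList p (suc n) rewrite countᵇ-++ p (reachList n) [ reach (suc n) ] | countᵇ-reachList p n =
  cong (sumTo (λ j → χ (p (reach j))) n +_) (+-identityʳ (χ (p (reach (suc n)))))

indeg-count : ∀ k → indeg k ≡ sumTo (λ j → χ (k ≤ᵇ reach j)) (k ∸ 1)
indeg-count k = countᵇ-reachList (k ≤ᵇ_) (k ∸ 1)

indeg-≤ : ∀ k → indeg k ≤ k ∸ 1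
indeg-≤ k = ≤-trans (≤-reflexive (indeg-count k)) (count-≤ (λ j → k ≤ᵇ reach j) (k ∸ 1))

-- The truncated subtraction defining reach is exact.
indeg+reach : ∀ k → indeg k + reach k ≡ 2 * k
indeg+reach k = m+[n∸m]≡n (≤-trans (indeg-≤ k) (≤-trans (m∸n≤m k 1) (m≤m+n k (k + 0))))

k<reach : ∀ {k} → 1 ≤ k → k < reach k
k<reach {suc k} _ = +-cancelˡ-< (indeg (suc k)) (suc k) (reach (suc k)) (begin-strict
  indeg (suc k) + suc k   <⟨ +-monoˡ-< (suc k) (s≤s (indeg-≤ (suc k))) ⟩
  suc k + suc k           ≡⟨ cong (suc k +_) (+-identityʳ (suc k)) ⟨
  2 * suc k               ≡⟨ indeg+reach (suc k) ⟨
  indeg (suc k) + reach (suc k) ∎)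
  where open ≤-Reasoning

indeg-suc : ∀ k → indeg (suc k) ≤ suc (indeg k)
indeg-suc zero    = z≤n
indeg-suc (suc k) = begin
  indeg (suc (suc k))
    ≡⟨ indeg-count (suc (suc k)) ⟩
  sumTo (λ j → χ (suc (suc k) ≤ᵇ reach j)) k + χ (suc (suc k) ≤ᵇ reach (suc k))
    ≤⟨ +-mono-≤ (sumTo-mono {g = λ j → χ (suc k ≤ᵇ reach j)} k (λ j _ _ → χ-≤ᵇ-antitone (reach j) (n≤1+n (suc k))))
                (χ≤1 (suc (suc k) ≤ᵇ reach (suc k))) ⟩
  sumTo (λ j → χ (suc k ≤ᵇ reach j)) k + 1
    ≡⟨ cong (_+ 1) (indeg-count (suc k)) ⟨
  indeg (suc k) + 1
    ≡⟨ +-comm (indeg (suc k)) 1 ⟩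
  suc (indeg (suc k)) ∎
  where open ≤-Reasoning

reach-suc : ∀ k → reach k < reach (suc k)
reach-suc k = +-cancelˡ-≤ (indeg (suc k)) (suc (reach k)) (reach (suc k)) (begin
  indeg (suc k) + suc (reach k)    ≤⟨ +-monoˡ-≤ (suc (reach k)) (indeg-suc k) ⟩
  suc (indeg k + suc (reach k))    ≡⟨ cong suc (+-suc (indeg k) (reach k)) ⟩
  suc (suc (indeg k + reach k))    ≡⟨ cong (λ x → suc (suc x)) (indeg+reach k) ⟩
  suc (suc (2 * k))                ≡⟨ *-suc 2 k ⟨
  2 * suc k                        ≡⟨ indeg+reach (suc k) ⟨
  indeg (suc k) + reach (suc k)    ∎)
  where open ≤-Reasoning

reach-mono : ∀ {i j} → i ≤ j → reach i ≤ reach j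
reach-mono {j = zero} z≤n = ≤-refl
reach-mono {i} {suc j} i≤sj with m≤n⇒m<n∨m≡n i≤sj
... | inj₁ i<sj = ≤-trans (reach-mono (s≤s⁻¹ i<sj)) (<⇒≤ (reach-suc j))
... | inj₂ refl = ≤-refl

adj-forward : ∀ {j k} → j < k → adj j k ≡ (k ≤ᵇ reach j)
adj-forward {j} {k} j<k rewrite <ᵇ-true j<k | <ᵇ-false {k} {j} (<⇒≤ j<k) = ∨-identityʳ (k ≤ᵇ reach j)

adj-backward : ∀ {j k} → j < k → adj k j ≡ (k ≤ᵇ reach j)
adj-backward {j} {k} j<k rewrite <ᵇ-false {k} {j} (<⇒≤ j<k) | <ᵇ-true j<k = refl

adj-irrefl : ∀ k → adj k k ≡ false
adj-irrefl k rewrite <ᵇ-false {k} {k} ≤-refl = refl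

deg-split : ∀ k l → 1 ≤ k → deg (k + l) k ≡ indeg k + sumTo (λ j → χ (k + j ≤ᵇ reach k)) l
deg-split (suc k) l _ = begin
  deg (suc k + l) (suc k)
    ≡⟨ countᵇ-verts (adj (suc k)) (suc k + l) ⟩
  sumTo f (suc k + l)
    ≡⟨ sumTo-split f (suc k) l ⟩
  sumTo f k + f (suc k) + sumTo (λ j → f (suc k + j)) l
    ≡⟨ cong₂ _+_ (cong₂ _+_ predecessors (cong χ (adj-irrefl (suc k)))) successors ⟩
  sumTo (λ j → χ (suc k ≤ᵇ reach j)) k + 0 + sumTo (λ j → χ (suc k + j ≤ᵇ reach (suc k))) l
    ≡⟨ cong (_+ sumTo (λ j → χ (suc k + j ≤ᵇ reach (suc k))) l)
            (trans (+-identityʳ _) (sym (indeg-count (suc k)))) ⟩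
  indeg (suc k) + sumTo (λ j → χ (suc k + j ≤ᵇ reach (suc k))) l ∎
  where
  open ≡-Reasoning
  f : ℕ → ℕ
  f j = χ (adj (suc k) j)
  predecessors : sumTo f k ≡ sumTo (λ j → χ (suc k ≤ᵇ reach j)) k
  predecessors = sumTo-cong k (λ j _ j≤k → cong χ (adj-backward (s≤s j≤k)))
  successors : sumTo (λ j → f (suc k + j)) l ≡ sumTo (λ j → χ (suc k + j ≤ᵇ reach (suc k))) l
  successors = sumTo-cong l (λ j 1≤j _ → cong χ (adj-forward (m<m+n (suc k) 1≤j)))

deg-formula : ∀ {n k} → 1 ≤ k → k ≤ n → deg n k ≡ indeg k + (reach k ∸ k) ⊓ (n ∸ k)
deg-formula {n} {k} 1≤k k≤n = begin
  deg n k                                             ≡⟨ cong (λ m → deg m k) (m+[n∸m]≡n k≤n) ⟨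
  deg (k + (n ∸ k)) k                                 ≡⟨ deg-split k (n ∸ k) 1≤k ⟩
  indeg k + sumTo (λ j → χ (k + j ≤ᵇ reach k)) (n ∸ k) ≡⟨ cong (indeg k +_) (count-window k (reach k) (n ∸ k)) ⟩
  indeg k + (reach k ∸ k) ⊓ (n ∸ k)                   ∎
  where open ≡-Reasoning

deg-within : ∀ {n k} → 1 ≤ k → k ≤ n → reach k ≤ n → deg n k ≡ k
deg-within {n} {k} 1≤k k≤n inside = begin
  deg n k                           ≡⟨ deg-formula 1≤k k≤n ⟩
  indeg k + (reach k ∸ k) ⊓ (n ∸ k) ≡⟨ cong (indeg k +_) (m≤n⇒m⊓n≡m (∸-monoˡ-≤ k inside)) ⟩
  indeg k + (reach k ∸ k)           ≡⟨ +-∸-assoc (indeg k) (<⇒≤ (k<reach 1≤k)) ⟨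
  indeg k + reach k ∸ k             ≡⟨ cong (_∸ k) (indeg+reach k) ⟩
  k + (k + 0) ∸ k                   ≡⟨ m+n∸m≡n k (k + 0) ⟩
  k + 0                             ≡⟨ +-identityʳ k ⟩
  k                                 ∎
  where open ≡-Reasoning

deg-beyond : ∀ {n k} → 1 ≤ k → k ≤ n → n < reach k → deg n k ≡ indeg k + (n ∸ k)
deg-beyond {n} {k} 1≤k k≤n beyond =
  trans (deg-formula 1≤k k≤n) (cong (indeg k +_) (m≥n⇒m⊓n≡n (∸-monoˡ-≤ k (<⇒≤ beyond))))

deg-beyond-< : ∀ {n k} → 1 ≤ k → k ≤ n → n < reach k → deg n k < k
deg-beyond-< {n} {k} 1≤k k≤n beyond = +-cancelʳ-< k (deg n k) k (begin-strict
  deg n k + k               ≡⟨ cong (_+ k) (deg-beyond 1≤k k≤n beyond) ⟩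
  indeg k + (n ∸ k) + k     ≡⟨ +-assoc (indeg k) (n ∸ k) k ⟩
  indeg k + (n ∸ k + k)     ≡⟨ cong (indeg k +_) (m∸n+n≡m k≤n) ⟩
  indeg k + n               <⟨ +-monoʳ-< (indeg k) beyond ⟩
  indeg k + reach k         ≡⟨ indeg+reach k ⟩
  k + (k + 0)               ≡⟨ cong (k +_) (+-identityʳ k) ⟩
  k + k                     ∎)
  where open ≤-Reasoning

deg-step-beyond : ∀ {n k} → 1 ≤ k → suc k ≤ n → n < reach (suc k) → deg n (suc k) ≤ deg n k
deg-step-beyond {suc n} {k} 1≤k sk≤sn beyond with reach k ≤? suc n
... | yes inside = begin
  deg (suc n) (suc k)  ≤⟨ s≤s⁻¹ (deg-beyond-< (s≤s z≤n) sk≤sn beyond) ⟩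
  k                    ≡⟨ deg-within 1≤k (≤-trans (n≤1+n k) sk≤sn) inside ⟨
  deg (suc n) k        ∎
  where open ≤-Reasoning
... | no outside = begin
  deg (suc n) (suc k)          ≡⟨ deg-beyond (s≤s z≤n) sk≤sn beyond ⟩
  indeg (suc k) + (n ∸ k)      ≤⟨ +-monoˡ-≤ (n ∸ k) (indeg-suc k) ⟩
  suc (indeg k + (n ∸ k))      ≡⟨ +-suc (indeg k) (n ∸ k) ⟨
  indeg k + suc (n ∸ k)        ≡⟨ cong (indeg k +_) (+-∸-assoc 1 (s≤s⁻¹ sk≤sn)) ⟨
  indeg k + (suc n ∸ k)        ≡⟨ deg-beyond 1≤k (≤-trans (n≤1+n k) sk≤sn) (≰⇒> outside) ⟨
  deg (suc n) k                ∎
  where open ≤-Reasoning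

-- If v_{i+1} also reached inside J_n(1), it would have degree i + 1 > i = deg_n(v_i).
prime-Jaconian-next-beyond : ∀ {n i} → IsPrimeJaconian n i → n < reach (suc i)
prime-Jaconian-next-beyond {n} {i} (1≤i , i≤n , maximal , _) with reach (suc i) ≤? n
... | no outside = ≰⇒> outside
... | yes inside = contradiction (maximal (suc i) (s≤s z≤n) si≤n) (<⇒≱ larger)
  where
  si≤n : suc i ≤ n
  si≤n = ≤-trans (<⇒≤ (k<reach (s≤s z≤n))) inside
  larger : deg n i < deg n (suc i)
  larger = subst₂ _<_ (sym (deg-within 1≤i i≤n (≤-trans (reach-mono (n≤1+n i)) inside)))
                      (sym (deg-within (s≤s z≤n) si≤n inside)) ≤-refl

-- If v_i reached beyond J_n(1), its predecessor would have at least its degree.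
prime-Jaconian-within : ∀ {n i} → 2 ≤ n → IsPrimeJaconian n i → reach i ≤ n
prime-Jaconian-within {n} {i} 2≤n (1≤i , i≤n , _ , earlier-smaller) with reach i ≤? n
... | yes inside = inside
... | no outside = ⊥-elim (no-prime-beyond i 1≤i i≤n (≰⇒> outside) earlier-smaller)
  where
  -- reach 1 = 2 ≤ n, and for i ≥ 2 use deg-step-beyond at i − 1.
  no-prime-beyond : ∀ i → 1 ≤ i → i ≤ n → n < reach i → (∀ k → 1 ≤ k → k < i → deg n k < deg n i) → ⊥
  no-prime-beyond (suc zero)    _ _   beyond _       = <⇒≱ beyond 2≤n
  no-prime-beyond (suc (suc i)) _ i≤n beyond earlier =
    <⇒≱ (earlier (suc i) (s≤s z≤n) ≤-refl) (deg-step-beyond (s≤s z≤n) i≤n beyond)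

isTriangle : ℕ → ℕ → ℕ → Bool
isTriangle a b c = (a <ᵇ b) ∧ (b <ᵇ c) ∧ adj a b ∧ adj b c ∧ adj a c

triangleSum : ℕ → ℕ
triangleSum N = sumTo (λ a → sumTo (λ b → sumTo (λ c → χ (isTriangle a b c)) N) N) N

triangles-sum : ∀ n → triangles n ≡ triangleSum n
triangles-sum n =
  trans (countᵇ-concatMap-verts _ _ n) (sumTo-cong n (λ a _ _ →
  trans (countᵇ-concatMap-verts _ _ n) (sumTo-cong n (λ b _ _ →
  trans (countᵇ-concatMap-verts _ _ n) (sumTo-cong n (λ c _ _ → singleton-count (isTriangle a b c) a))))))
  where
  singleton-count : ∀ (t : Bool) (a : ℕ) → countᵇ (λ _ → true) (if t then [ a ] else []) ≡ χ t
  singleton-count true  a = refl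
  singleton-count false a = refl

newTriangles : ℕ → ℕ
newTriangles n = sumTo (λ a → sumTo (λ b → χ (isTriangle a b (suc n))) n) n

triangles-suc : ∀ n → triangles (suc n) ≡ triangles n + newTriangles n
triangles-suc n = begin
  triangles (suc n)                         ≡⟨ triangles-sum (suc n) ⟩
  sumTo (λ a → byA a) n + byA (suc n)       ≡⟨ cong (sumTo (λ a → byA a) n +_) (sumTo-vanish (suc n) top-first) ⟩
  sumTo (λ a → byA a) n + 0                 ≡⟨ +-identityʳ _ ⟩
  sumTo (λ a → byA a) n                     ≡⟨ sumTo-cong n (λ a _ _ → split-at-top a) ⟩
  sumTo (λ a → old a + new a) n             ≡⟨ sumTo-+ old new n ⟩
  triangleSum n + newTriangles n            ≡⟨ cong (_+ newTriangles n) (triangles-sum n) ⟨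
  triangles n + newTriangles n              ∎
  where
  open ≡-Reasoning
  byAB : ℕ → ℕ → ℕ
  byAB a b = sumTo (λ c → χ (isTriangle a b c)) (suc n)
  byA : ℕ → ℕ
  byA a = sumTo (byAB a) (suc n)
  old new : ℕ → ℕ
  old a = sumTo (λ b → sumTo (λ c → χ (isTriangle a b c)) n) n
  new a = sumTo (λ b → χ (isTriangle a b (suc n))) n
  top-first : ∀ b → 1 ≤ b → b ≤ suc n → sumTo (λ c → χ (isTriangle (suc n) b c)) (suc n) ≡ 0
  top-first b _ b≤sn rewrite <ᵇ-false {suc n} {b} b≤sn = sumTo-vanish (suc n) (λ _ _ _ → refl)
  top-middle : ∀ a c → 1 ≤ c → c ≤ suc n → χ (isTriangle a (suc n) c) ≡ 0
  top-middle a c _ c≤sn rewrite <ᵇ-false {suc n} {c} c≤sn | ∧-zeroʳ (a <ᵇ suc n) = refl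
  split-at-top : ∀ a → byA a ≡ old a + new a
  split-at-top a = begin
    sumTo (byAB a) n + byAB a (suc n) ≡⟨ cong (sumTo (byAB a) n +_) (sumTo-vanish (suc n) (top-middle a)) ⟩
    sumTo (byAB a) n + 0              ≡⟨ +-identityʳ _ ⟩
    sumTo (byAB a) n                  ≡⟨ sumTo-+ _ _ n ⟩
    old a + new a                     ∎

-- Σ_{j=1}^{m-1} (m − j) = Σ_{j=1}^m (m ∸ j), the last term being 0.
innerSum-sumTo : ∀ m → innerSum m ≡ sumTo (λ j → m ∸ j) m
innerSum-sumTo zero    = refl
innerSum-sumTo (suc m) = begin
  innerSum (suc m)                        ≡⟨ sum-map-verts (suc m ∸_) m ⟩
  sumTo (suc m ∸_) m                      ≡⟨ +-identityʳ _ ⟨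
  sumTo (suc m ∸_) m + 0                  ≡⟨ cong (sumTo (suc m ∸_) m +_) (n∸n≡0 m) ⟨
  sumTo (λ j → suc m ∸ j) (suc m)         ∎
  where open ≡-Reasoning

-- The new triangles when v_i is the last vertex whose reach stays inside J_n(1):
-- the neighbours of v_{n+1} are then v_{i+1}, …, v_n, and they are pairwise adjacent.
module NewVertex (n i : ℕ) (i≤n : i ≤ n) (inside : reach i ≤ n) (beyond : n < reach (suc i)) where

  adj-new : ∀ {j} → j ≤ n → adj j (suc n) ≡ (i <ᵇ j)
  adj-new {j} j≤n with i <? j
  ... | yes i<j = trans (adj-forward (s≤s j≤n))
                        (trans (≤ᵇ-true (<-≤-trans beyond (reach-mono i<j))) (sym (<ᵇ-true i<j)))
  ... | no i≮j  = trans (adj-forward (s≤s j≤n))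
                        (trans (≤ᵇ-false (s≤s (≤-trans (reach-mono (≮⇒≥ i≮j)) inside)))
                               (sym (<ᵇ-false (≮⇒≥ i≮j))))

  isTriangle-new : ∀ {a b} → a ≤ n → b ≤ n → isTriangle a b (suc n) ≡ (a <ᵇ b) ∧ (i <ᵇ a)
  isTriangle-new {a} {b} a≤n b≤n = begin
    isTriangle a b (suc n)
      ≡⟨ cong₂ (λ x y → (a <ᵇ b) ∧ x ∧ adj a b ∧ y) (<ᵇ-true (s≤s b≤n))
               (cong₂ _∧_ (adj-new b≤n) (adj-new a≤n)) ⟩
    (a <ᵇ b) ∧ true ∧ adj a b ∧ (i <ᵇ b) ∧ (i <ᵇ a)
      ≡⟨ ∧-absorb (a <ᵇ b) (i <ᵇ a) (adj a b) (i <ᵇ b) implied ⟩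
    (a <ᵇ b) ∧ (i <ᵇ a) ∎
    where
    open ≡-Reasoning
    -- for i < a < b ≤ n, v_a reaches v_b since reach a > n
    implied : (a <ᵇ b) ≡ true → (i <ᵇ a) ≡ true → adj a b ≡ true × (i <ᵇ b) ≡ true
    implied a<ᵇb i<ᵇa =
      trans (adj-forward a<b) (≤ᵇ-true (≤-trans b≤n (<⇒≤ (<-≤-trans beyond (reach-mono i<a))))) ,
      <ᵇ-true (<-trans i<a a<b)
      where
      a<b : a < b
      a<b = <ᵇ-sound a<ᵇb
      i<a : i < a
      i<a = <ᵇ-sound i<ᵇa

  newTriangles-at : ∀ {a} → a ≤ n → sumTo (λ b → χ (isTriangle a b (suc n))) n ≡ χ (i <ᵇ a) * (n ∸ a)
  newTriangles-at {a} a≤n =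
    trans (sumTo-cong n (λ b _ b≤n → cong χ (isTriangle-new a≤n b≤n))) (by-position (i <? a))
    where
    by-position : Dec (i < a) → sumTo (λ b → χ ((a <ᵇ b) ∧ (i <ᵇ a))) n ≡ χ (i <ᵇ a) * (n ∸ a)
    by-position (yes i<a) rewrite <ᵇ-true i<a =
      trans (sumTo-cong n (λ b _ _ → cong χ (∧-identityʳ (a <ᵇ b))))
            (trans (count-above a n) (sym (+-identityʳ (n ∸ a))))
    by-position (no i≮a) rewrite <ᵇ-false (≮⇒≥ i≮a) =
      sumTo-vanish n (λ b _ _ → cong χ (∧-zeroʳ (a <ᵇ b)))

  newTriangles-count : newTriangles n ≡ innerSum (n ∸ i)
  newTriangles-count = begin
    newTriangles n                              ≡⟨ sumTo-cong n (λ a _ a≤n → newTriangles-at a≤n) ⟩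
    sumTo (λ a → χ (i <ᵇ a) * (n ∸ a)) n        ≡⟨ cong (sumTo (λ a → χ (i <ᵇ a) * (n ∸ a))) n≡i+m ⟩
    sumTo (λ a → χ (i <ᵇ a) * (n ∸ a)) (i + m)  ≡⟨ sumTo-tail (n ∸_) i m ⟩
    sumTo (λ j → n ∸ (i + j)) m                 ≡⟨ sumTo-cong m (λ j _ _ → shift j) ⟩
    sumTo (λ j → m ∸ j) m                       ≡⟨ innerSum-sumTo m ⟨
    innerSum m                                  ∎
    where
    open ≡-Reasoning
    m : ℕ
    m = n ∸ i
    n≡i+m : n ≡ i + m
    n≡i+m = sym (m+[n∸m]≡n i≤n)
    shift : ∀ j → n ∸ (i + j) ≡ m ∸ j
    shift j = trans (cong (_∸ (i + j)) n≡i+m) ([m+n]∸[m+o]≡n∸o i m j)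

theorem3p3 : (n i : ℕ) → 4 ≤ n → IsPrimeJaconian n i →
    triangles (suc n) ≡ triangles n + innerSum (n ∸ i)
theorem3p3 n i 4≤n jaconian@(_ , i≤n , _) = begin
  triangles (suc n)                 ≡⟨ triangles-suc n ⟩
  triangles n + newTriangles n      ≡⟨ cong (triangles n +_) (NewVertex.newTriangles-count n i i≤n inside beyond) ⟩
  triangles n + innerSum (n ∸ i)    ∎
  where
  open ≡-Reasoning
  inside : reach i ≤ n
  inside = prime-Jaconian-within (≤-trans (s≤s (s≤s z≤n)) 4≤n) jaconian
  beyond : n < reach (suc i)
  beyond = prime-Jaconian-next-beyond jaconian
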